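{- Let $R$ be a relation, $\Sigma_{\mathrm{FD}}$ a set of functional dependencies on $R$ closed under FD implication, and $\Sigma_{\mathrm{UFD}}$ the set of unary FDs implied by $\Sigma_{\mathrm{FD}}$. If $O\subseteq\mathrm{Pos}(R)$ is safe for $\Sigma_{\mathrm{UFD}}$, then there is no FD $R^L\to R^r$ in $\Sigma_{\mathrm{FD}}$ with $R^L\subseteq O$ and $R^r\notin O$.
   Context: $\mathrm{Pos}(R)=\{R^1,\dots,R^{|R|}\}$. An FD $R^L\to R^r$ ($L$ nonempty) states that two $R$-facts agreeing on $L$ agree on $R^r$; unary if $|L|=1$; the unary key dependency $R^q\to O$ is the conjunction of $R^q\to R^o$ for $R^o\in O$. A set $O\subseteq\mathrm{Pos}(R)$ is safe for $\Sigma_{\mathrm{UFD}}$ if $O=\emptyset$ or for every $R^p\in\mathrm{Pos}(R)\setminus O$ there is $R^q\in\mathrm{Pos}(R)$ such that $R^q\to O$ is implied by $\Sigma_{\mathrm{UFD}}$ but $R^q\to R^p$ is not. -}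

module Defs where

open import Data.Nat using (ℕ)
open import Data.Fin using (Fin)
open import Data.Fin.Subset using (Subset; _∈_; _∉_; _⊆_; ∣_∣; Nonempty; Empty)
open import Data.Product using (Σ; _×_)
open import Data.Sum using (_⊎_)
open import Relation.Nullary using (¬_)
open import Relation.Binary.PropositionalEquality using (_≡_)
open import Level using (suc; zero)

-- A relation R of arity n; its positions Pos(R) = {R^1,…,R^n} are Fin n.
-- An R-fact is a tuple of constants (domain ℕ); an instance is a set of R-facts.
Fact : ℕ → Set
Fact n = Fin n → ℕ

Instance : ℕ → Set₁
Instance n = Fact n → Set

record FD (n : ℕ) : Set where
  constructor mkFD
  field
    lhs      : Subset n
    rhs      : Fin n
    nonempty : Nonempty lhs
open FD public

Unary : ∀ {n} → FD n → Set
Unary φ = ∣ lhs φ ∣ ≡ 1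

AgreeOn : ∀ {n} → Subset n → Fact n → Fact n → Set
AgreeOn L f g = ∀ i → i ∈ L → f i ≡ g i

Satisfies : ∀ {n} → Instance n → FD n → Set
Satisfies I φ = ∀ f g → I f → I g → AgreeOn (lhs φ) f g → f (rhs φ) ≡ g (rhs φ)

FDSet : ℕ → Set₂
FDSet n = FD n → Set₁

SatisfiesAll : ∀ {n} → Instance n → FDSet n → Set₁
SatisfiesAll I Σ' = ∀ φ → Σ' φ → Satisfies I φ

_⊨_ : ∀ {n} → FDSet n → FD n → Set₁
Σ' ⊨ φ = (I : Instance _) → SatisfiesAll I Σ' → Satisfies I φ

ClosedUnderImplication : ∀ {n} → FDSet n → Set₁
ClosedUnderImplication Σ' = ∀ φ → Σ' ⊨ φ → Σ' φ

UFDsOf : ∀ {n} → FDSet n → FDSet n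
UFDsOf Σ' φ = Unary φ × Σ' ⊨ φ

unaryFD : ∀ {n} → Fin n → Fin n → FD n
unaryFD {n} q p = mkFD (Data.Fin.Subset.⁅_⁆ q) p (q , Data.Fin.Subset.Properties.x∈⁅x⁆ q)
  where open import Data.Product using (_,_)
        import Data.Fin.Subset.Properties

-- R^q → O is implied: conjunction of R^q → R^o for R^o ∈ O.
ImpliesKey : ∀ {n} → FDSet n → Fin n → Subset n → Set₁
ImpliesKey Σ' q O = ∀ o → o ∈ O → Σ' ⊨ unaryFD q o

Safe : ∀ {n} → FDSet n → Subset n → Set₁
Safe {n} ΣU O =
  Lift (suc zero) (Empty O) ⊎
  (∀ p → p ∉ O → Σ (Fin n) λ q → ImpliesKey ΣU q O × ¬ (ΣU ⊨ unaryFD q p))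
  where open Level using (Lift)

module Submission where

-- If O = ∅ this is immediate, since L is nonempty.  Otherwise safety, applied to
-- the position r ∉ O, yields q such that Σ_UFD implies R^q → O but not R^q → R^r.
-- But R^q → O gives R^q → R^l for every l ∈ L, and then R^L → R^r gives R^q → R^r
-- (transitivity of FD implication); being unary, R^q → R^r is implied by Σ_UFD.

open import Defs
open import Data.Nat using (ℕ)
open import Data.Fin using (Fin)
open import Data.Fin.Subset using (Subset; _∈_; _⊆_; _∉_; Nonempty; Empty)
open import Data.Fin.Subset.Properties using (∣⁅x⁆∣≡1)
open import Data.Product using (Σ; _×_; _,_)
open import Data.Sum using (inj₁; inj₂)
open import Relation.Nullary using (¬_)
open import Level using (lift)

member-implied : ∀ {n} {Σ' : FDSet n} {φ : FD n} → Σ' φ → Σ' ⊨ φ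
member-implied φ∈ I satI = satI _ φ∈

model-of-UFDs : ∀ {n} {Σ' : FDSet n} {I : Instance n} →
  SatisfiesAll I Σ' → SatisfiesAll I (UFDsOf Σ')
model-of-UFDs satI ψ (_ , Σ'⊨ψ) = Σ'⊨ψ _ satI

UFDs-implied-by-Σ : ∀ {n} {Σ' : FDSet n} {φ : FD n} → UFDsOf Σ' ⊨ φ → Σ' ⊨ φ
UFDs-implied-by-Σ UFDs⊨φ I satI = UFDs⊨φ I (model-of-UFDs satI)

unary-implied-by-UFDs : ∀ {n} (Σ' : FDSet n) (q p : Fin n) →
  Σ' ⊨ unaryFD q p → UFDsOf Σ' ⊨ unaryFD q p
unary-implied-by-UFDs Σ' q p Σ'⊨qp =
  member-implied {Σ' = UFDsOf Σ'} {unaryFD q p} (∣⁅x⁆∣≡1 q , Σ'⊨qp)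

transitivity : ∀ {n} {Σ' : FDSet n} (q : Fin n) (φ : FD n) →
  (∀ l → l ∈ lhs φ → Σ' ⊨ unaryFD q l) → Σ' ⊨ φ → Σ' ⊨ unaryFD q (rhs φ)
transitivity q φ q→L Σ'⊨φ I satI f g If Ig f≈g-on-q =
  Σ'⊨φ I satI f g If Ig λ l l∈L → q→L l l∈L I satI f g If Ig f≈g-on-q

nonempty-subset : ∀ {n} {L O : Subset n} → Nonempty L → L ⊆ O → ¬ Empty O
nonempty-subset (x , x∈L) L⊆O O-empty = O-empty (x , L⊆O x∈L)

mainTheorem7 : (n : ℕ) (ΣFD : FDSet n) → ClosedUnderImplication ΣFD →
    (O : Subset n) → Safe (UFDsOf ΣFD) O →
    ¬ (Σ (FD n) λ φ → ΣFD φ × lhs φ ⊆ O × rhs φ ∉ O)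
mainTheorem7 n ΣFD _ O (inj₁ (lift O-empty)) (φ , _ , L⊆O , _) =
  nonempty-subset (nonempty φ) L⊆O O-empty
mainTheorem7 n ΣFD _ O (inj₂ safe) (φ , φ∈ΣFD , L⊆O , r∉O)
  with safe (rhs φ) r∉O
... | q , q→O , q↛r = q↛r (unary-implied-by-UFDs ΣFD q (rhs φ) ΣFD⊨q→r)
  where
  q→L : ∀ l → l ∈ lhs φ → ΣFD ⊨ unaryFD q l
  q→L l l∈L = UFDs-implied-by-Σ {Σ' = ΣFD} {unaryFD q l} (q→O l (L⊆O l∈L))

  ΣFD⊨q→r : ΣFD ⊨ unaryFD q (rhs φ)
  ΣFD⊨q→r = transitivity q φ q→L (member-implied {Σ' = ΣFD} φ∈ΣFD)
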